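{- The class of path graphs $\{P_n:n\in\mathbb{N}\}$ is $\le_{\mathrm{sg}}$-complete for $\mathsf{G}\,\mathrm{FO}(=)$, i.e. it belongs to $\mathsf{G}\,\mathrm{FO}(=)$ and every graph class in $\mathsf{G}\,\mathrm{FO}(=)$ is $\le_{\mathrm{sg}}$-reducible to it.
   Context: Graphs are finite directed graphs (possibly with self-loops); undirected graphs are those with symmetric edge relation; a graph class is a set of finite graphs closed under isomorphism. $P_n$ is the undirected path on $n$ vertices. For $n\ge1$, $\mathcal{N}_n$ is the structure with universe $\{0,\dots,n\}$. $\mathrm{FO}_k(=)$ denotes first-order formulas with $k$ free variables using only equality. A logical labeling scheme is $(\varphi,c)$ with $\varphi\in\mathrm{FO}_{2k}(=)$, $c,k\in\mathbb{N}$; a graph $G$ with $n$ vertices is in $\mathrm{gr}(\varphi,c)$ if there is $\ell\colon V(G)\to\{0,\dots,n^c\}^k$ with $(u,v)\in E(G)\iff\mathcal{N}_{n^c},(\ell(u),\ell(v))\models\varphi$ for all $u,v$. $\mathsf{G}\,\mathrm{FO}(=)$ is the set of graph classes contained in some such $\mathrm{gr}(\varphi,c)$. For a $k^2$-ary boolean function $f$ and a $k\times k$ $0/1$-matrix $A$, $f(A)$ is $f$ applied to the entries of $A$ read row by row. Given graphs $G,H$, $G$ has an $(H,f)$-representation if there is $\ell\colon V(G)\to V(H)^k$ such that for all distinct $u,v\in V(G)$: $(u,v)\in E(G)\iff f(A^\ell_{uv})=1$, where $(A^\ell_{uv})_{i,j}=1$ iff $(\ell(u)_i,\ell(v)_j)\in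 E(H)$. For graph classes, $\mathcal{C}\le_{\mathrm{sg}}\mathcal{D}$ if there are $c,k\in\mathbb{N}$ and a $k^2$-ary boolean function $f$ such that for all $n$ and every $G\in\mathcal{C}$ with $n$ vertices there is $H\in\mathcal{D}$ with $n^c$ vertices such that $G$ has an $(H,f)$-representation. -}

module Defs where

open import Data.Nat as ℕ using (ℕ; _+_; _*_; _^_; _≡ᵇ_)
open import Data.Fin using (Fin; toℕ; zero; suc)
open import Data.Sum using (_⊎_)
open import Data.Bool using (Bool; true; false; _∨_)
open import Data.Vec using (Vec; _++_; lookup; tabulate; concat)
open import Data.Product using (Σ; _×_; _,_)
open import Data.Empty using (⊥)
open import Relation.Nullary using (¬_)
open import Relation.Binary.PropositionalEquality using (_≡_; _≢_)
open import Function.Bundles using (_↔_; _⇔_; Inverse)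

record Graph : Set where
  field
    size : ℕ
    E    : Fin size → Fin size → Bool
open Graph public

_≅_ : Graph → Graph → Set
G ≅ H = Σ (Fin (size G) ↔ Fin (size H)) λ σ →
          ∀ u v → E G u v ≡ E H (Inverse.to σ u) (Inverse.to σ v)

IsoClosed : (Graph → Set) → Set
IsoClosed C = ∀ G H → G ≅ H → C G → C H

P : ℕ → Graph
P n = record { size = n
             ; E = λ i j → (ℕ.suc (toℕ i) ≡ᵇ toℕ j) ∨ (ℕ.suc (toℕ j) ≡ᵇ toℕ i) }

PathClass : Graph → Set
PathClass G = Σ ℕ λ n → G ≅ P n

-- First-order logic with equality only (de Bruijn style):
-- Formula n = formulas whose free variables are among n variables.

data Formula : ℕ → Set where
  eq   : ∀ {n} → Fin n → Fin n → Formula n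
  neg  : ∀ {n} → Formula n → Formula n
  and  : ∀ {n} → Formula n → Formula n → Formula n
  or   : ∀ {n} → Formula n → Formula n → Formula n
  ex   : ∀ {n} → Formula (ℕ.suc n) → Formula n
  all  : ∀ {n} → Formula (ℕ.suc n) → Formula n

_▹_ : ∀ {A : Set} {n} → (Fin n → A) → A → (Fin (ℕ.suc n) → A)
(ρ ▹ a) zero = a
(ρ ▹ a) (suc i) = ρ i

-- Satisfaction in the structure N_m with universe {0,…,m} = Fin (suc m)
-- (pure set, the only relation is equality).
Sat : (m : ℕ) → ∀ {n} → Formula n → (Fin n → Fin (ℕ.suc m)) → Set
Sat m (eq i j)  ρ = ρ i ≡ ρ j
Sat m (neg φ)   ρ = ¬ Sat m φ ρ
Sat m (and φ ψ) ρ = Sat m φ ρ × Sat m ψ ρ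
Sat m (or φ ψ)  ρ = Sat m φ ρ ⊎ Sat m ψ ρ
Sat m (ex φ)    ρ = Σ (Fin (ℕ.suc m)) λ a → Sat m φ (ρ ▹ a)
Sat m (all φ)   ρ = (a : Fin (ℕ.suc m)) → Sat m φ (ρ ▹ a)

InGr : (k : ℕ) → Formula (k + k) → ℕ → Graph → Set
InGr k φ c G =
  Σ (Fin (size G) → Vec (Fin (ℕ.suc (size G ^ c))) k) λ ℓ →
    ∀ u v → (E G u v ≡ true) ⇔ Sat (size G ^ c) φ (lookup (ℓ u ++ ℓ v))

InGFO : (Graph → Set) → Set
InGFO C = Σ ℕ λ k → Σ ℕ λ c → Σ (Formula (k + k)) λ φ →
            ∀ G → C G → InGr k φ c G

adjMatrix : ∀ {k} (H : Graph) → Vec (Fin (size H)) k → Vec (Fin (size H)) k →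
            Vec Bool (k * k)
adjMatrix H x y = concat (tabulate λ i → tabulate λ j → E H (lookup x i) (lookup y j))

HasRep : (k : ℕ) → (Vec Bool (k * k) → Bool) → Graph → Graph → Set
HasRep k f G H =
  Σ (Fin (size G) → Vec (Fin (size H)) k) λ ℓ →
    ∀ u v → u ≢ v → (E G u v ≡ true) ⇔ (f (adjMatrix H (ℓ u) (ℓ v)) ≡ true)

_≤sg_ : (Graph → Set) → (Graph → Set) → Set
C ≤sg D = Σ ℕ λ c → Σ ℕ λ k → Σ (Vec Bool (k * k) → Bool) λ f →
            ∀ G → C G → Σ Graph λ H →
              D H × (size H ≡ size G ^ c) × HasRep k f G H

-- Paths are in G FO(=) via the labels (i, i + 1).  For the reduction, let φ have 2k free variables and
-- quantifier rank q, and put T = 2k + q.  By the back-and-forth argument, once M ≥ T the truth of φ in N_M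
-- under an assignment depends only on the equality type of the assignment; so it is determined by bounded
-- data: min(M, T), the equality type, and, when M < T, the assignment itself.  A vertex u is sent to a
-- tuple of vertices of a path of length n^{c'} that spells these data out: the points 0, 3, …, 3T form a
-- ruler common to all labels, a number x ≤ T is placed at 3x + 1 and read off as its unique neighbour on
-- the other vertex's ruler, and each entry y of ℓ(u) is placed at 3y and 3y + 1, so that an entry y of
-- ℓ(u) equals an entry y' of ℓ(v) iff 3y + 1 is adjacent to 3y'.  Equalities among the entries of ℓ(u)
-- itself are recorded as numbers (the index of the first equal entry).  A fixed Boolean function of the
-- adjacency matrix decodes these data and evaluates φ in N_{min(M,T)}.

module Submission where

open import Defs
open import Data.Bool using (Bool; true; false; _∨_; if_then_else_)
open import Data.Bool.Properties using (T-≡; T-∨; ∨-comm)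
open import Data.Fin using (Fin; zero; suc; toℕ; fromℕ<; _↑ˡ_; _↑ʳ_; splitAt; combine; #_)
open import Data.Fin.Properties
  using (toℕ-fromℕ<; toℕ-injective; toℕ<n; toℕ≤pred[n]; _≟_; any?; all?; ¬∀⟶∃¬; injective⇒≤;
         splitAt-↑ˡ; splitAt-↑ʳ)
open import Data.Nat
  using (ℕ; zero; suc; _+_; _*_; _^_; _⊔_; _⊓_; _≡ᵇ_; _≤_; _<_; z≤n; s≤s; _<?_; NonZero; >-nonZero)
open import Data.Nat.Properties hiding (_≟_)
open import Data.Nat.Tactic.RingSolver using (solve-∀)
open import Data.Product using (∃; _×_; _,_; proj₁; proj₂; map₂)
open import Data.Sum as Sum using (_⊎_; inj₁; inj₂; [_,_]′)
open import Data.Vec using (Vec; _∷_; []; lookup; tabulate)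
open import Data.Vec.Properties using (lookup∘tabulate; lookup-concat; lookup-splitAt)
open import Function using (_∘_; Injective)
open import Function.Bundles using (_⇔_; _↔_; mk⇔; Equivalence; Inverse; Injection)
open import Function.Properties.Equivalence using () renaming (sym to ⇔-sym; trans to ⇔-trans)
open import Function.Properties.Inverse using (↔-refl; ↔-sym; ↔⇒↣)
open import Relation.Nullary using (Dec; yes; no; does; ¬?; contradiction)
open import Relation.Nullary.Decidable using (_×-dec_; _⊎-dec_)
open import Relation.Binary.PropositionalEquality

open Equivalence using (to; from)

clamp : ∀ {N} → Fin N → ℕ → Fin N
clamp {N} d x with x <? N
... | yes x<N = fromℕ< x<N
... | no _    = d

toℕ-clamp : ∀ {N} (d : Fin N) {x} → x < N → toℕ (clamp d x) ≡ x
toℕ-clamp {N} d {x} x<N with x <? N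
... | yes x<N' = toℕ-fromℕ< x<N'
... | no x≮N   = contradiction x<N x≮N

clamp-toℕ : ∀ {N} (d a : Fin N) → clamp d (toℕ a) ≡ a
clamp-toℕ d a = toℕ-injective (toℕ-clamp d (toℕ<n a))

clamp-injective : ∀ {N} (d : Fin N) {x y} → x < N → y < N → clamp d x ≡ clamp d y → x ≡ y
clamp-injective d {x} {y} x<N y<N e = begin
  x                ≡⟨ toℕ-clamp d x<N ⟨
  toℕ (clamp d x)  ≡⟨ cong toℕ e ⟩
  toℕ (clamp d y)  ≡⟨ toℕ-clamp d y<N ⟩
  y                ∎
  where open ≡-Reasoning

does⇔ : ∀ {A : Set} (a? : Dec A) → (does a? ≡ true) ⇔ A
does⇔ (yes a) = mk⇔ (λ _ → a) (λ _ → refl)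
does⇔ (no ¬a) = mk⇔ (λ ()) (λ a → contradiction a ¬a)

≡ᵇ⇔≡ : ∀ m n → ((m ≡ᵇ n) ≡ true) ⇔ (m ≡ n)
≡ᵇ⇔≡ m n = ⇔-trans (⇔-sym T-≡) (mk⇔ (≡ᵇ⇒≡ m n) (≡⇒≡ᵇ m n))

toℕ⇔ : ∀ {m} (a b : Fin m) → (toℕ a ≡ toℕ b) ⇔ (a ≡ b)
toℕ⇔ a b = mk⇔ toℕ-injective (cong toℕ)

≡-sym⇔ : ∀ {A : Set} {a b : A} → (a ≡ b) ⇔ (b ≡ a)
≡-sym⇔ = mk⇔ sym sym

≡true-cong : ∀ {b b' : Bool} → b ≡ b' → (b ≡ true) ⇔ (b' ≡ true)
≡true-cong e = mk⇔ (trans (sym e)) (trans e)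

-- E (P n) i j is definitionally adjacent (toℕ i) (toℕ j).

adjacent : ℕ → ℕ → Bool
adjacent a b = (suc a ≡ᵇ b) ∨ (suc b ≡ᵇ a)

adjacent⇔ : ∀ a b → (adjacent a b ≡ true) ⇔ (suc a ≡ b ⊎ suc b ≡ a)
adjacent⇔ a b = ⇔-trans (⇔-sym (T-≡ {adjacent a b}))
  (⇔-trans T-∨ (mk⇔ (Sum.map (≡ᵇ⇒≡ _ _) (≡ᵇ⇒≡ _ _)) (Sum.map (≡⇒≡ᵇ _ _) (≡⇒≡ᵇ _ _))))

adjacent-sym : ∀ a b → adjacent a b ≡ adjacent b a
adjacent-sym a b = ∨-comm (suc a ≡ᵇ b) (suc b ≡ᵇ a)

2+3x≢3y : ∀ x y → suc (suc (x * 3)) ≢ y * 3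
2+3x≢3y x       zero    ()
2+3x≢3y zero    (suc y) ()
2+3x≢3y (suc x) (suc y) e = 2+3x≢3y x y (suc-injective (suc-injective (suc-injective e)))

adjacent-1+3x-3y : ∀ x y → (adjacent (suc (x * 3)) (y * 3) ≡ true) ⇔ (y ≡ x)
adjacent-1+3x-3y x y = ⇔-trans (adjacent⇔ (suc (x * 3)) (y * 3)) (mk⇔ forward backward)
  where
  forward : suc (suc (x * 3)) ≡ y * 3 ⊎ suc (y * 3) ≡ suc (x * 3) → y ≡ x
  forward (inj₁ e) = contradiction e (2+3x≢3y x y)
  forward (inj₂ e) = *-cancelʳ-≡ y x 3 (suc-injective e)
  backward : y ≡ x → suc (suc (x * 3)) ≡ y * 3 ⊎ suc (y * 3) ≡ suc (x * 3)
  backward refl = inj₂ refl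

adjacent-3y-1+3x : ∀ x y → (adjacent (y * 3) (suc (x * 3)) ≡ true) ⇔ (y ≡ x)
adjacent-3y-1+3x x y rewrite adjacent-sym (y * 3) (suc (x * 3)) = adjacent-1+3x-3y x y

Sat? : ∀ m {n} (φ : Formula n) ρ → Dec (Sat m φ ρ)
Sat? m (eq i j)  ρ = ρ i ≟ ρ j
Sat? m (neg φ)   ρ = ¬? (Sat? m φ ρ)
Sat? m (and φ ψ) ρ = Sat? m φ ρ ×-dec Sat? m ψ ρ
Sat? m (or φ ψ)  ρ = Sat? m φ ρ ⊎-dec Sat? m ψ ρ
Sat? m (ex φ)    ρ = any? λ a → Sat? m φ (ρ ▹ a)
Sat? m (all φ)   ρ = all? λ a → Sat? m φ (ρ ▹ a)

▹-cong : ∀ {A : Set} {n} {ρ ρ' : Fin n → A} → ρ ≗ ρ' → ∀ a → ρ ▹ a ≗ ρ' ▹ a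
▹-cong e a zero    = refl
▹-cong e a (suc i) = e i

Sat-resp : ∀ m {n} (φ : Formula n) {ρ ρ'} → ρ ≗ ρ' → Sat m φ ρ → Sat m φ ρ'
Sat-resp m (eq i j)  e s         = trans (sym (e i)) (trans s (e j))
Sat-resp m (neg φ)   e ¬s s'     = ¬s (Sat-resp m φ (sym ∘ e) s')
Sat-resp m (and φ ψ) e (s , t)   = Sat-resp m φ e s , Sat-resp m ψ e t
Sat-resp m (or φ ψ)  e (inj₁ s)  = inj₁ (Sat-resp m φ e s)
Sat-resp m (or φ ψ)  e (inj₂ s)  = inj₂ (Sat-resp m ψ e s)
Sat-resp m (ex φ)    e (a , s)   = a , Sat-resp m φ (▹-cong e a) s
Sat-resp m (all φ)   e s a       = Sat-resp m φ (▹-cong e a) (s a)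

Sat-resp⇔ : ∀ m {n} (φ : Formula n) {ρ ρ'} → ρ ≗ ρ' → Sat m φ ρ ⇔ Sat m φ ρ'
Sat-resp⇔ m φ e = mk⇔ (Sat-resp m φ e) (Sat-resp m φ (sym ∘ e))

rank : ∀ {n} → Formula n → ℕ
rank (eq _ _)  = 0
rank (neg φ)   = rank φ
rank (and φ ψ) = rank φ ⊔ rank ψ
rank (or φ ψ)  = rank φ ⊔ rank ψ
rank (ex φ)    = suc (rank φ)
rank (all φ)   = suc (rank φ)

SameEqType : ∀ {j A B} → (Fin j → Fin A) → (Fin j → Fin B) → Set
SameEqType ρ ρ' = ∀ p q → (ρ p ≡ ρ q) ⇔ (ρ' p ≡ ρ' q)

SameEqType-sym : ∀ {j A B} {ρ : Fin j → Fin A} {ρ' : Fin j → Fin B} →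
                 SameEqType ρ ρ' → SameEqType ρ' ρ
SameEqType-sym r p q = ⇔-sym (r p q)

SameEqType-▹ : ∀ {j A B} {ρ : Fin j → Fin A} {ρ' : Fin j → Fin B} {a a'} →
               SameEqType ρ ρ' → (∀ i → (ρ i ≡ a) ⇔ (ρ' i ≡ a')) →
               SameEqType (ρ ▹ a) (ρ' ▹ a')
SameEqType-▹ r h zero    zero    = mk⇔ (λ _ → refl) (λ _ → refl)
SameEqType-▹ r h zero    (suc q) = ⇔-trans ≡-sym⇔ (⇔-trans (h q) ≡-sym⇔)
SameEqType-▹ r h (suc p) zero    = h p
SameEqType-▹ r h (suc p) (suc q) = r p q

∃-missing : ∀ {j m} (ρ : Fin j → Fin m) → j < m → ∃ λ b → ∀ i → ρ i ≢ b
∃-missing {j} {m} ρ j<m =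
  map₂ (λ ¬hit i e → ¬hit (i , e))
    (¬∀⟶∃¬ m Hit (λ b → any? λ i → ρ i ≟ b) (<⇒≱ j<m ∘ injective⇒≤ ∘ section-injective))
  where
  Hit : Fin m → Set
  Hit b = ∃ λ i → ρ i ≡ b
  section-injective : (hit : ∀ b → Hit b) → Injective _≡_ _≡_ (proj₁ ∘ hit)
  section-injective hit {b} {b'} e = trans (sym (proj₂ (hit b))) (trans (cong ρ e) (proj₂ (hit b')))

SameEqType-extend : ∀ {j A B} {ρ : Fin j → Fin A} {ρ' : Fin j → Fin B} → SameEqType ρ ρ' → j < B →
                    ∀ a → ∃ λ a' → SameEqType (ρ ▹ a) (ρ' ▹ a')
SameEqType-extend {ρ = ρ} {ρ'} r j<B a with any? (λ i → ρ i ≟ a)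
... | yes (i , ρi≡a) = ρ' i , SameEqType-▹ r λ q →
          ⇔-trans (mk⇔ (λ e → trans e (sym ρi≡a)) (λ e → trans e ρi≡a)) (r q i)
... | no a-missing with ∃-missing ρ' j<B
...   | b , b-missing = b , SameEqType-▹ r λ q →
          mk⇔ (λ e → contradiction (q , e) a-missing) (λ e → contradiction e (b-missing q))

+suc-≤⇒suc+-≤ : ∀ {j r X} → j + suc r ≤ X → suc j + r ≤ X
+suc-≤⇒suc+-≤ {j} {r} {X} = subst (_≤ X) (+-suc j r)

suc+-≤⇒< : ∀ {j r X} → suc j + r ≤ X → j < X
suc+-≤⇒< {j} {r} = ≤-trans (m≤m+n (suc j) r)

-- With r quantifiers still to play on j assigned elements, structures of size at least j + r always
-- have a fresh element to answer with.
Sat-transfer : ∀ {j A B r} (φ : Formula j) {ρ : Fin j → Fin (suc A)} {ρ' : Fin j → Fin (suc B)} →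
               rank φ ≤ r → j + r ≤ suc A → j + r ≤ suc B → SameEqType ρ ρ' → Sat A φ ρ → Sat B φ ρ'
Sat-transfer (eq p q)  _ _ _ ρ≈ρ' s = to (ρ≈ρ' p q) s
Sat-transfer (neg φ)   rk hA hB ρ≈ρ' ¬s s' = ¬s (Sat-transfer φ rk hB hA (SameEqType-sym ρ≈ρ') s')
Sat-transfer (and φ ψ) rk hA hB ρ≈ρ' (s , t) =
  Sat-transfer φ (m⊔n≤o⇒m≤o _ _ rk) hA hB ρ≈ρ' s , Sat-transfer ψ (m⊔n≤o⇒n≤o _ _ rk) hA hB ρ≈ρ' t
Sat-transfer (or φ ψ)  rk hA hB ρ≈ρ' (inj₁ s) = inj₁ (Sat-transfer φ (m⊔n≤o⇒m≤o _ _ rk) hA hB ρ≈ρ' s)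
Sat-transfer (or φ ψ)  rk hA hB ρ≈ρ' (inj₂ t) = inj₂ (Sat-transfer ψ (m⊔n≤o⇒n≤o _ _ rk) hA hB ρ≈ρ' t)
Sat-transfer (ex φ)  (s≤s rk) hA hB ρ≈ρ' (a , s)
  with SameEqType-extend ρ≈ρ' (suc+-≤⇒< (+suc-≤⇒suc+-≤ hB)) a
... | a' , ρa≈ρ'a' = a' , Sat-transfer φ rk (+suc-≤⇒suc+-≤ hA) (+suc-≤⇒suc+-≤ hB) ρa≈ρ'a' s
Sat-transfer (all φ) (s≤s rk) hA hB ρ≈ρ' s a'
  with SameEqType-extend (SameEqType-sym ρ≈ρ') (suc+-≤⇒< (+suc-≤⇒suc+-≤ hA)) a'
... | a , ρ'a'≈ρa =
  Sat-transfer φ rk (+suc-≤⇒suc+-≤ hA) (+suc-≤⇒suc+-≤ hB) (SameEqType-sym ρ'a'≈ρa) (s a)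

-- Returns j when g is nowhere true.
firstTrue : ∀ {j} → (Fin j → Bool) → ℕ
firstTrue {zero}  g = 0
firstTrue {suc j} g = if g zero then 0 else suc (firstTrue (g ∘ suc))

firstTrue-≤ : ∀ {j} (g : Fin j → Bool) → firstTrue g ≤ j
firstTrue-≤ {zero}  g = z≤n
firstTrue-≤ {suc j} g with g zero
... | true  = z≤n
... | false = s≤s (firstTrue-≤ (g ∘ suc))

firstTrue-cong : ∀ {j} {g h : Fin j → Bool} → g ≗ h → firstTrue g ≡ firstTrue h
firstTrue-cong {zero}  g≗h = refl
firstTrue-cong {suc j} {g} {h} g≗h rewrite g≗h zero with h zero
... | true  = refl
... | false = cong suc (firstTrue-cong (g≗h ∘ suc))

firstTrue-witness : ∀ {j} (g : Fin j → Bool) p → g p ≡ true → ∃ λ m → toℕ m ≡ firstTrue g × g m ≡ true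
firstTrue-witness {suc j} g p gp with g zero in g0
... | true = zero , refl , g0
firstTrue-witness {suc j} g zero    gp | false = contradiction (trans (sym gp) g0) λ ()
firstTrue-witness {suc j} g (suc p) gp | false with firstTrue-witness (g ∘ suc) p gp
... | m , m≡first , gm = suc m , cong suc m≡first , gm

firstTrue-unique : ∀ {j} (g : Fin j → Bool) a → (∀ t → (g t ≡ true) ⇔ (toℕ t ≡ a)) → a < j →
                   firstTrue g ≡ a
firstTrue-unique {suc j} g a g⇔a a<j with g zero in g0
firstTrue-unique {suc j} g zero    g⇔a a<j       | true  = refl
firstTrue-unique {suc j} g (suc a) g⇔a a<j       | true  = contradiction (to (g⇔a zero) g0) λ ()
firstTrue-unique {suc j} g zero    g⇔a a<j       | false = contradiction (trans (sym g0) (from (g⇔a zero) refl)) λ ()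
firstTrue-unique {suc j} g (suc a) g⇔a (s≤s a<j) | false =
  cong suc (firstTrue-unique (g ∘ suc) a (λ t → ⇔-trans (g⇔a (suc t)) (mk⇔ suc-injective (cong suc))) a<j)

true⇔true⇒≡ : ∀ {b b' : Bool} → (b ≡ true) ⇔ (b' ≡ true) → b ≡ b'
true⇔true⇒≡ {true}  {true}  _ = refl
true⇔true⇒≡ {true}  {false} h = sym (to h refl)
true⇔true⇒≡ {false} {true}  h = from h refl
true⇔true⇒≡ {false} {false} _ = refl

-- Index of the first variable equal to a given one: a canonical name for its equality class.
firstTrue-eqClass : ∀ {j} {X : Set} (g : Fin j → Fin j → Bool) (ρ : Fin j → X) →
                    (∀ p q → (g p q ≡ true) ⇔ (ρ p ≡ ρ q)) →
                    ∀ p q → (firstTrue (g p) ≡ firstTrue (g q)) ⇔ (ρ p ≡ ρ q)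
firstTrue-eqClass g ρ g⇔ρ p q = mk⇔ forward backward
  where
  forward : firstTrue (g p) ≡ firstTrue (g q) → ρ p ≡ ρ q
  forward e with firstTrue-witness (g p) p (from (g⇔ρ p p) refl)
               | firstTrue-witness (g q) q (from (g⇔ρ q q) refl)
  ... | m , m≡ , gpm | m' , m'≡ , gqm' with toℕ-injective {i = m} {j = m'} (trans m≡ (trans e (sym m'≡)))
  ... | refl = trans (to (g⇔ρ p m) gpm) (sym (to (g⇔ρ q m) gqm'))
  backward : ρ p ≡ ρ q → firstTrue (g p) ≡ firstTrue (g q)
  backward ρp≡ρq = firstTrue-cong λ i → true⇔true⇒≡
    (⇔-trans (g⇔ρ p i) (⇔-trans (mk⇔ (trans (sym ρp≡ρq)) (trans ρp≡ρq)) (⇔-sym (g⇔ρ q i))))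

P-∈-PathClass : ∀ n → PathClass (P n)
P-∈-PathClass n = n , ↔-refl , λ _ _ → refl

adjacent⇔clamp : ∀ {m} a b → suc a ≤ m → suc b ≤ m →
                 (adjacent a b ≡ true) ⇔
                 (clamp {suc m} zero (suc a) ≡ clamp zero b ⊎ clamp zero (suc b) ≡ clamp zero a)
adjacent⇔clamp a b 1+a≤m 1+b≤m = ⇔-trans (adjacent⇔ a b) (mk⇔
  (Sum.map (cong (clamp zero)) (cong (clamp zero)))
  (Sum.map (clamp-injective zero (s≤s 1+a≤m) (s≤s (<⇒≤ 1+b≤m)))
           (clamp-injective zero (s≤s 1+b≤m) (s≤s (<⇒≤ 1+a≤m)))))

-- On labels (i, i + 1) and (j, j + 1): i + 1 = j or j + 1 = i.
pathFormula : Formula (2 + 2)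
pathFormula = or (eq (# 1) (# 2)) (eq (# 3) (# 0))

PathClass∈GFO : InGFO PathClass
PathClass∈GFO = 2 , 1 , pathFormula , λ { G (n , σ , E≡) → label G σ , λ u v →
  ⇔-trans (≡true-cong (E≡ u v))
          (adjacent⇔clamp _ _ (bound G σ (Inverse.to σ u)) (bound G σ (Inverse.to σ v))) }
  where
  bound : ∀ G {n} (σ : Fin (size G) ↔ Fin n) (i : Fin n) → suc (toℕ i) ≤ size G ^ 1
  bound G σ i = ≤-trans (≤-trans (toℕ<n i) (injective⇒≤ (Injection.injective (↔⇒↣ (↔-sym σ)))))
                        (≤-reflexive (sym (*-identityʳ (size G))))
  label : ∀ G {n} → Fin (size G) ↔ Fin n → Fin (size G) → Vec (Fin (suc (size G ^ 1))) 2
  label G σ u = clamp zero (toℕ (Inverse.to σ u)) ∷ clamp zero (suc (toℕ (Inverse.to σ u))) ∷ []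

n<2^n : ∀ n → n < 2 ^ n
n<2^n zero    = s≤s z≤n
n<2^n (suc n) = subst (suc (suc n) ≤_) (cong (2 ^ n +_) (sym (+-identityʳ (2 ^ n))))
                      (+-mono-≤ (m^n>0 2 n) (n<2^n n))

distinct⇒2≤ : ∀ {n} {u v : Fin n} → u ≢ v → 2 ≤ n
distinct⇒2≤ {suc zero}    {zero} {zero} u≢v = contradiction refl u≢v
distinct⇒2≤ {suc (suc n)}                u≢v = s≤s (s≤s z≤n)

lookup-adjMatrix : ∀ {k} (H : Graph) (x y : Vec (Fin (size H)) k) i j →
                   lookup (adjMatrix H x y) (combine i j) ≡ E H (lookup x i) (lookup y j)
lookup-adjMatrix {k} H x y i j = begin
  lookup (adjMatrix H x y) (combine i j) ≡⟨ lookup-concat rows i j ⟩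
  lookup (lookup rows i) j               ≡⟨ cong (λ r → lookup r j) (lookup∘tabulate row i) ⟩
  lookup (row i) j                       ≡⟨ lookup∘tabulate (λ j → E H (lookup x i) (lookup y j)) j ⟩
  E H (lookup x i) (lookup y j)          ∎
  where
  open ≡-Reasoning
  row : Fin k → Vec Bool k
  row i = tabulate λ j → E H (lookup x i) (lookup y j)
  rows : Vec (Vec Bool k) k
  rows = tabulate row

3[m+t]+2≤m*[3t+5] : ∀ m t → 0 < m → suc (suc ((m + t) * 3)) ≤ m * suc (suc (suc t * 3))
3[m+t]+2≤m*[3t+5] (suc m) t _ = subst (suc (suc ((suc m + t) * 3)) ≤_) (split m t) (m≤m+n _ _)
  where
  split : ∀ m t → suc (suc ((suc m + t) * 3)) + m * suc (suc (t * 3)) ≡ suc m * suc (suc (suc t * 3))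
  split = solve-∀

module Reduction {k : ℕ} (φ : Formula (k + k)) where

  T : ℕ
  T = k + k + rank φ

  -- Slots of a label: the ruler, the number min(M, T), the first-occurrence numbers of the k entries,
  -- then the low (3y) and the high (3y + 1) point of every entry.
  K : ℕ
  K = suc T + (suc k + (k + k))

  refSlot : Fin (suc T) → Fin K
  refSlot t = t ↑ˡ (suc k + (k + k))

  sizeSlot : Fin K
  sizeSlot = suc T ↑ʳ (zero {k} ↑ˡ (k + k))

  firstSlot loSlot hiSlot : Fin k → Fin K
  firstSlot a = suc T ↑ʳ (suc a ↑ˡ (k + k))
  loSlot    a = suc T ↑ʳ (suc k ↑ʳ (a ↑ˡ k))
  hiSlot    a = suc T ↑ʳ (suc k ↑ʳ (k ↑ʳ a))

  firstOccurrence : ∀ {M} → (Fin k → Fin (suc M)) → Fin k → ℕ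
  firstOccurrence l a = firstTrue λ b → does (l a ≟ l b)

  firstOccurrence-≤ : ∀ {M} (l : Fin k → Fin (suc M)) a → firstOccurrence l a ≤ T
  firstOccurrence-≤ l a = ≤-trans (firstTrue-≤ _) (≤-trans (m≤m+n k k) (m≤m+n (k + k) (rank φ)))

  referencePoint : Fin (suc T) → ℕ
  referencePoint t = toℕ t * 3

  numberPoint : ∀ {M} → (Fin k → Fin (suc M)) → Fin (suc k) → ℕ
  numberPoint {M} l zero    = suc ((M ⊓ T) * 3)
  numberPoint     l (suc a) = suc (firstOccurrence l a * 3)

  lowPoint highPoint : ∀ {M} → (Fin k → Fin (suc M)) → Fin k → ℕ
  lowPoint  l a = toℕ (l a) * 3
  highPoint l a = suc (lowPoint l a)

  valuePoint : ∀ {M} → (Fin k → Fin (suc M)) → Fin (k + k) → ℕ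
  valuePoint l = [ lowPoint l , highPoint l ]′ ∘ splitAt k

  nonReferencePoint : ∀ {M} → (Fin k → Fin (suc M)) → Fin (suc k + (k + k)) → ℕ
  nonReferencePoint l = [ numberPoint l , valuePoint l ]′ ∘ splitAt (suc k)

  position : ∀ {M} → (Fin k → Fin (suc M)) → Fin K → ℕ
  position l = [ referencePoint , nonReferencePoint l ]′ ∘ splitAt (suc T)

  position-ref : ∀ {M} (l : Fin k → Fin (suc M)) t → position l (refSlot t) ≡ toℕ t * 3
  position-ref l t = cong [ referencePoint , nonReferencePoint l ]′ (splitAt-↑ˡ (suc T) t _)

  position-size : ∀ {M} (l : Fin k → Fin (suc M)) → position l sizeSlot ≡ suc ((M ⊓ T) * 3)
  position-size l = cong [ referencePoint , nonReferencePoint l ]′ (splitAt-↑ʳ (suc T) _ _)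

  position-first : ∀ {M} (l : Fin k → Fin (suc M)) a → position l (firstSlot a) ≡ suc (firstOccurrence l a * 3)
  position-first l a = trans (cong [ referencePoint , nonReferencePoint l ]′ (splitAt-↑ʳ (suc T) _ _))
                             (cong [ numberPoint l , valuePoint l ]′ (splitAt-↑ˡ (suc k) (suc a) _))

  position-lo : ∀ {M} (l : Fin k → Fin (suc M)) a → position l (loSlot a) ≡ toℕ (l a) * 3
  position-lo l a = trans (cong [ referencePoint , nonReferencePoint l ]′ (splitAt-↑ʳ (suc T) _ _))
                   (trans (cong [ numberPoint l , valuePoint l ]′ (splitAt-↑ʳ (suc k) _ _))
                          (cong [ lowPoint l , highPoint l ]′ (splitAt-↑ˡ k a k)))

  position-hi : ∀ {M} (l : Fin k → Fin (suc M)) a → position l (hiSlot a) ≡ suc (toℕ (l a) * 3)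
  position-hi l a = trans (cong [ referencePoint , nonReferencePoint l ]′ (splitAt-↑ʳ (suc T) _ _))
                   (trans (cong [ numberPoint l , valuePoint l ]′ (splitAt-↑ʳ (suc k) _ _))
                          (cong [ lowPoint l , highPoint l ]′ (splitAt-↑ʳ k k a)))

  position-≤ : ∀ {M} (l : Fin k → Fin (suc M)) i → position l i ≤ suc ((M + T) * 3)
  position-≤ {M} l i with splitAt (suc T) i
  ... | inj₁ t = m≤n⇒m≤1+n (*-monoˡ-≤ 3 (≤-trans (toℕ≤pred[n] t) (m≤n+m T M)))
  ... | inj₂ i with splitAt (suc k) i
  ...   | inj₁ zero    = s≤s (*-monoˡ-≤ 3 (≤-trans (m⊓n≤n M T) (m≤n+m T M)))
  ...   | inj₁ (suc a) = s≤s (*-monoˡ-≤ 3 (≤-trans (firstOccurrence-≤ l a) (m≤n+m T M)))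
  ...   | inj₂ i with splitAt k i
  ...     | inj₁ a = m≤n⇒m≤1+n (*-monoˡ-≤ 3 (≤-trans (toℕ≤pred[n] (l a)) (m≤m+n M T)))
  ...     | inj₂ a = s≤s (*-monoˡ-≤ 3 (≤-trans (toℕ≤pred[n] (l a)) (m≤m+n M T)))

  -- Below T the size and the values are known exactly; from T on only the equality type matters, and it is
  -- realised in N_T by the first-occurrence indices.
  evaluate : ℕ → (Fin (k + k) → ℕ) → (Fin (k + k) → Fin (k + k) → Bool) → Bool
  evaluate s value sameValue with s <? T
  ... | yes _ = does (Sat? s φ (clamp zero ∘ value))
  ... | no _  = does (Sat? T φ (clamp zero ∘ firstTrue ∘ sameValue))

  evaluate-small : ∀ {M} (ρ : Fin (k + k) → Fin (suc M)) value sameValue → M < T → value ≗ toℕ ∘ ρ →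
                   (evaluate M value sameValue ≡ true) ⇔ Sat M φ ρ
  evaluate-small {M} ρ value sameValue M<T value≗ρ with M <? T
  ... | no M≮T = contradiction M<T M≮T
  ... | yes _  = ⇔-trans (does⇔ (Sat? M φ _))
                         (Sat-resp⇔ M φ λ p → trans (cong (clamp zero) (value≗ρ p)) (clamp-toℕ zero (ρ p)))

  evaluate-large : ∀ {M} (ρ : Fin (k + k) → Fin (suc M)) value sameValue → T ≤ M →
                   (∀ p q → (sameValue p q ≡ true) ⇔ (ρ p ≡ ρ q)) →
                   (evaluate T value sameValue ≡ true) ⇔ Sat M φ ρ
  evaluate-large {M} ρ value sameValue T≤M sameValue⇔ with T <? T
  ... | yes T<T = contradiction T<T (<-irrefl refl)
  ... | no _    = ⇔-trans (does⇔ (Sat? T φ canonical))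
                          (mk⇔ (Sat-transfer φ ≤-refl roomT roomM canonical≈ρ)
                               (Sat-transfer φ ≤-refl roomM roomT (SameEqType-sym canonical≈ρ)))
    where
    canonical : Fin (k + k) → Fin (suc T)
    canonical = clamp zero ∘ firstTrue ∘ sameValue
    roomT : k + k + rank φ ≤ suc T
    roomT = n≤1+n T
    roomM : k + k + rank φ ≤ suc M
    roomM = m≤n⇒m≤1+n T≤M
    first<1+T : ∀ p → firstTrue (sameValue p) < suc T
    first<1+T p = s≤s (≤-trans (firstTrue-≤ (sameValue p)) (m≤m+n (k + k) (rank φ)))
    canonical≈ρ : SameEqType canonical ρ
    canonical≈ρ p q = ⇔-trans (mk⇔ (clamp-injective zero (first<1+T p) (first<1+T q)) (cong (clamp zero)))
                              (firstTrue-eqClass sameValue ρ sameValue⇔ p q)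

  evaluate-correct : ∀ {M} (ρ : Fin (k + k) → Fin (suc M)) value sameValue →
                     (M < T → value ≗ toℕ ∘ ρ) → (∀ p q → (sameValue p q ≡ true) ⇔ (ρ p ≡ ρ q)) →
                     (evaluate (M ⊓ T) value sameValue ≡ true) ⇔ Sat M φ ρ
  evaluate-correct {M} ρ value sameValue value≗ρ sameValue⇔ with M <? T
  ... | yes M<T rewrite m≤n⇒m⊓n≡m (<⇒≤ M<T) = evaluate-small ρ value sameValue M<T (value≗ρ M<T)
  ... | no M≮T  rewrite m≥n⇒m⊓n≡n (≮⇒≥ M≮T) = evaluate-large ρ value sameValue (≮⇒≥ M≮T) sameValue⇔

  module Decoder (B : Fin K → Fin K → Bool) where

    read₁ read₂ : Fin K → ℕ
    read₁ i = firstTrue λ t → B i (refSlot t)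
    read₂ j = firstTrue λ t → B (refSlot t) j

    value : Fin (k + k) → ℕ
    value p = [ read₁ ∘ hiSlot , read₂ ∘ hiSlot ]′ (splitAt k p)

    sameValue : Fin k ⊎ Fin k → Fin k ⊎ Fin k → Bool
    sameValue (inj₁ a) (inj₁ b) = read₁ (firstSlot a) ≡ᵇ read₁ (firstSlot b)
    sameValue (inj₂ a) (inj₂ b) = read₂ (firstSlot a) ≡ᵇ read₂ (firstSlot b)
    sameValue (inj₁ a) (inj₂ b) = B (hiSlot a) (loSlot b)
    sameValue (inj₂ a) (inj₁ b) = B (hiSlot b) (loSlot a)

    decode : Bool
    decode = evaluate (read₁ sizeSlot) value λ p q → sameValue (splitAt k p) (splitAt k q)

  module _ {M} (l₁ l₂ : Fin k → Fin (suc M)) (B : Fin K → Fin K → Bool)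
           (B≡adjacent : ∀ i j → B i j ≡ adjacent (position l₁ i) (position l₂ j)) where
    open Decoder B

    B-at : ∀ i j {x y} → position l₁ i ≡ x → position l₂ j ≡ y → B i j ≡ adjacent x y
    B-at i j e₁ e₂ = trans (B≡adjacent i j) (cong₂ adjacent e₁ e₂)

    read₁-number : ∀ {i x} → position l₁ i ≡ suc (x * 3) → x ≤ T → read₁ i ≡ x
    read₁-number {i} {x} e x≤T = firstTrue-unique _ x
      (λ t → ⇔-trans (≡true-cong (B-at i (refSlot t) e (position-ref l₂ t))) (adjacent-1+3x-3y x (toℕ t)))
      (s≤s x≤T)

    read₂-number : ∀ {j x} → position l₂ j ≡ suc (x * 3) → x ≤ T → read₂ j ≡ x
    read₂-number {j} {x} e x≤T = firstTrue-unique _ x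
      (λ t → ⇔-trans (≡true-cong (B-at (refSlot t) j (position-ref l₁ t) e)) (adjacent-3y-1+3x x (toℕ t)))
      (s≤s x≤T)

    assignment : Fin (k + k) → Fin (suc M)
    assignment p = [ l₁ , l₂ ]′ (splitAt k p)

    value-correct : M < T → value ≗ toℕ ∘ assignment
    value-correct M<T p with splitAt k p
    ... | inj₁ a = read₁-number (position-hi l₁ a) (≤-trans (toℕ≤pred[n] (l₁ a)) (<⇒≤ M<T))
    ... | inj₂ a = read₂-number (position-hi l₂ a) (≤-trans (toℕ≤pred[n] (l₂ a)) (<⇒≤ M<T))

    read₁-first : ∀ a → read₁ (firstSlot a) ≡ firstOccurrence l₁ a
    read₁-first a = read₁-number (position-first l₁ a) (firstOccurrence-≤ l₁ a)

    read₂-first : ∀ a → read₂ (firstSlot a) ≡ firstOccurrence l₂ a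
    read₂-first a = read₂-number (position-first l₂ a) (firstOccurrence-≤ l₂ a)

    sameValue-correct : ∀ x y → (sameValue x y ≡ true) ⇔ ([ l₁ , l₂ ]′ x ≡ [ l₁ , l₂ ]′ y)
    sameValue-correct (inj₁ a) (inj₁ b) =
      ⇔-trans (≡true-cong (cong₂ _≡ᵇ_ (read₁-first a) (read₁-first b)))
              (⇔-trans (≡ᵇ⇔≡ _ _) (firstTrue-eqClass _ l₁ (λ a b → does⇔ (l₁ a ≟ l₁ b)) a b))
    sameValue-correct (inj₂ a) (inj₂ b) =
      ⇔-trans (≡true-cong (cong₂ _≡ᵇ_ (read₂-first a) (read₂-first b)))
              (⇔-trans (≡ᵇ⇔≡ _ _) (firstTrue-eqClass _ l₂ (λ a b → does⇔ (l₂ a ≟ l₂ b)) a b))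
    sameValue-correct (inj₁ a) (inj₂ b) =
      ⇔-trans (≡true-cong (B-at (hiSlot a) (loSlot b) (position-hi l₁ a) (position-lo l₂ b)))
              (⇔-trans (adjacent-1+3x-3y _ _) (⇔-trans (toℕ⇔ (l₂ b) (l₁ a)) ≡-sym⇔))
    sameValue-correct (inj₂ a) (inj₁ b) =
      ⇔-trans (≡true-cong (B-at (hiSlot b) (loSlot a) (position-hi l₁ b) (position-lo l₂ a)))
              (⇔-trans (adjacent-1+3x-3y _ _) (toℕ⇔ (l₂ a) (l₁ b)))

    decode-correct : (decode ≡ true) ⇔ Sat M φ assignment
    decode-correct =
      ⇔-trans (≡true-cong (cong (λ s → evaluate s value _) (read₁-number (position-size l₁) (m⊓n≤n M T))))
              (evaluate-correct assignment value _ value-correct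
                                λ p q → sameValue-correct (splitAt k p) (splitAt k q))

  extraExponent : ℕ
  extraExponent = suc (suc (suc T * 3))

  exponent : ℕ → ℕ
  exponent c = c + extraExponent

  positions-fit : ∀ {n} c → 2 ≤ n → suc (suc ((n ^ c + T) * 3)) ≤ n ^ exponent c
  positions-fit {n} c 2≤n = begin
    suc (suc ((n ^ c + T) * 3)) ≤⟨ 3[m+t]+2≤m*[3t+5] (n ^ c) T (m^n>0 n c) ⟩
    n ^ c * extraExponent       ≤⟨ *-monoʳ-≤ (n ^ c) extraExponent≤n^extraExponent ⟩
    n ^ c * n ^ extraExponent   ≡⟨ ^-distribˡ-+-* n c extraExponent ⟨
    n ^ exponent c              ∎
    where
    open ≤-Reasoning
    extraExponent≤n^extraExponent : extraExponent ≤ n ^ extraExponent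
    extraExponent≤n^extraExponent = ≤-trans (<⇒≤ (n<2^n extraExponent)) (^-monoˡ-≤ extraExponent 2≤n)
    instance
      n≢0 : NonZero n
      n≢0 = >-nonZero (≤-trans (s≤s z≤n) 2≤n)

  -- The vertex argument only witnesses that the path is non-empty.
  pathPoint : ∀ {n} c → Fin n → ℕ → Fin (n ^ exponent c)
  pathPoint {suc n} c _ = clamp (fromℕ< (m^n>0 (suc n) (exponent c)))

  toℕ-pathPoint : ∀ {n} c (u : Fin n) {x} → x < n ^ exponent c → toℕ (pathPoint c u x) ≡ x
  toℕ-pathPoint {suc n} c u = toℕ-clamp _

  label : ∀ {n} c → (Fin n → Vec (Fin (suc (n ^ c))) k) → Fin n → Vec (Fin (n ^ exponent c)) K
  label c ℓ u = tabulate (pathPoint c u ∘ position (lookup (ℓ u)))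

  decoder : Vec Bool (K * K) → Bool
  decoder bs = Decoder.decode λ i j → lookup bs (combine i j)

  label-represents : ∀ c G → InGr k φ c G → HasRep K decoder G (P (size G ^ exponent c))
  label-represents c G (ℓ , ℓ-represents) = label c ℓ , represents
    where
    path : Graph
    path = P (size G ^ exponent c)
    represents : ∀ u v → u ≢ v → (E G u v ≡ true) ⇔ (decoder (adjMatrix path (label c ℓ u) (label c ℓ v)) ≡ true)
    represents u v u≢v =
      ⇔-trans (ℓ-represents u v)
      (⇔-trans (Sat-resp⇔ _ φ (lookup-splitAt k (ℓ u) (ℓ v)))
               (⇔-sym (decode-correct (lookup (ℓ u)) (lookup (ℓ v)) _ entry≡adjacent)))
      where
      toℕ-point : ∀ w i → toℕ (lookup (label c ℓ w) i) ≡ position (lookup (ℓ w)) i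
      toℕ-point w i = trans (cong toℕ (lookup∘tabulate (pathPoint c w ∘ position (lookup (ℓ w))) i))
        (toℕ-pathPoint c w (≤-trans (s≤s (position-≤ _ i)) (positions-fit c (distinct⇒2≤ u≢v))))
      entry≡adjacent : ∀ i j → lookup (adjMatrix path (label c ℓ u) (label c ℓ v)) (combine i j)
                               ≡ adjacent (position (lookup (ℓ u)) i) (position (lookup (ℓ v)) j)
      entry≡adjacent i j = trans (lookup-adjMatrix path (label c ℓ u) (label c ℓ v) i j)
                                 (cong₂ adjacent (toℕ-point u i) (toℕ-point v j))

  reduction : ∀ c (C : Graph → Set) → (∀ G → C G → InGr k φ c G) → C ≤sg PathClass
  reduction c C C⊆gr = exponent c , K , decoder , λ G G∈C →
    P (size G ^ exponent c) , P-∈-PathClass _ , refl , label-represents c G (C⊆gr G G∈C)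

theorem6p19 : InGFO PathClass × (∀ (C : Graph → Set) → IsoClosed C → InGFO C → C ≤sg PathClass)
theorem6p19 = PathClass∈GFO , λ { C _ (k , c , φ , C⊆gr) → Reduction.reduction {k} φ c C C⊆gr }
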